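{- Up to isomorphism, there are exactly two non-empty finite digraphs $G$ satisfying all of the following: (1) every vertex of $G$ has out-degree $3$; (2) every edge of $G$ is dominated; (3) $G$ contains no $2$-cycle; (4) the undirected graph underlying $G$ is connected.
   Context: Digraphs have no loops and no parallel arcs in the same direction. A $2$-cycle is a pair of arcs $u\to v$, $v\to u$. An edge $u\to v$ is dominated if $u$ and $v$ have a common in-neighbor. -}

module Defs where

open import Data.Nat using (ℕ; zero; suc; _+_; _<_)
open import Data.Fin using (Fin; zero; suc)
open import Data.Bool using (Bool; true; false; if_then_else_)
open import Data.Product using (Σ; ∃; _×_; _,_)
open import Data.Sum using (_⊎_)
open import Relation.Nullary using (¬_)
open import Relation.Binary.PropositionalEquality using (_≡_)
open import Relation.Binary.Construct.Closure.ReflexiveTransitive using (Star)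
open import Function.Bundles using (_↔_; Inverse)

-- A digraph on vertex set Fin n: the arc relation is a Boolean adjacency
-- function (so "no parallel arcs in the same direction" is automatic),
-- together with looplessness.
record Digraph (n : ℕ) : Set where
  field
    arc    : Fin n → Fin n → Bool
    noLoop : ∀ u → arc u u ≡ false
open Digraph public

countᵇ : ∀ {n} → (Fin n → Bool) → ℕ
countᵇ {zero}  p = 0
countᵇ {suc n} p = (if p zero then 1 else 0) + countᵇ (λ i → p (suc i))

outDeg : ∀ {n} → Digraph n → Fin n → ℕ
outDeg G u = countᵇ (arc G u)

OutRegular3 : ∀ {n} → Digraph n → Set
OutRegular3 G = ∀ u → outDeg G u ≡ 3

Dominated : ∀ {n} → Digraph n → Set
Dominated {n} G = ∀ u v → arc G u v ≡ true →
  Σ (Fin n) λ w → (arc G w u ≡ true) × (arc G w v ≡ true)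

No2Cycle : ∀ {n} → Digraph n → Set
No2Cycle G = ∀ u v → arc G u v ≡ true → ¬ (arc G v u ≡ true)

UAdj : ∀ {n} → Digraph n → Fin n → Fin n → Set
UAdj G u v = (arc G u v ≡ true) ⊎ (arc G v u ≡ true)

WeaklyConnected : ∀ {n} → Digraph n → Set
WeaklyConnected G = ∀ u v → Star (UAdj G) u v

Good : ∀ {n} → Digraph n → Set
Good {n} G = (0 < n) × OutRegular3 G × Dominated G × No2Cycle G × WeaklyConnected G

Iso : ∀ {n m} → Digraph n → Digraph m → Set
Iso {n} {m} G H = Σ (Fin n ↔ Fin m) λ f →
  ∀ u v → arc G u v ≡ arc H (Inverse.to f u) (Inverse.to f v)

-- The three successors of a vertex w
-- span at most three arcs, and every arc u ⟶ v is spanned by the successors of each of its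
-- dominators. As G has 3n arcs, both estimates are tight: every arc has exactly one dominator,
-- the successors of every vertex span a tournament, and every in-degree is 3. That tournament
-- is never transitive (its sink would acquire the dominator of the arc from w as a fourth
-- predecessor), so it is a cyclic triangle a ⟶ b ⟶ c ⟶ a. Around a vertex v, with dominators
-- w, x, y of the arcs from v to a, b, c, the remaining arcs are then forced up to one binary
-- choice, which yields a homomorphism from H₇ or from H₈ into G. Any two vertices of H₇ (or H₈)
-- are adjacent or joined by a directed 2-path, so the homomorphism is injective; as all degrees
-- are 3 its image is closed under neighbours, and by connectivity it is an isomorphism.

module Submission where

open import Defs
open import Data.Bool using (Bool; true; false; _∧_; not; if_then_else_)
open import Data.Bool.ListAction using (any)
open import Data.Bool.Properties using (∧-identityʳ; T-≡)
import Data.Bool.Properties as Bool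
open import Data.Empty using (⊥; ⊥-elim)
open import Data.Fin using (Fin; zero; suc)
open import Data.Fin.Patterns using (0F; 1F; 2F; 3F; 4F; 5F; 6F; 7F)
open import Data.Fin.Properties using (_≟_; any?; all?; injective⇒≤)
open import Data.List using (List; []; _∷_; length)
open import Data.List.Membership.Propositional using (_∈_)
open import Data.List.Relation.Unary.All using (All; []; _∷_)
import Data.List.Relation.Unary.All as All
open import Data.List.Relation.Unary.AllPairs using ([]; _∷_)
open import Data.List.Relation.Unary.Any using (here; there)
import Data.List.Relation.Unary.Any as Any
open import Data.List.Relation.Unary.Any.Properties using (any⁻)
open import Data.List.Relation.Unary.Unique.Propositional using (Unique)
open import Data.Nat using (ℕ; zero; suc; _+_; _*_; _≤_; _<_; z≤n; s≤s)
import Data.Nat as ℕ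
open import Data.Nat.Properties
  using ( ≤-refl; ≤-pred; ≤-reflexive; ≤-trans; <-irrefl; ≤-antisym; m≤m+n; m≤n+m; m≤n⇒m≤1+n
        ; +-suc; +-comm; +-identityʳ; +-mono-≤; +-mono-<-≤; +-mono-≤-<; +-monoˡ-≤; +-monoʳ-≤
        ; +-cancelˡ-≤; +-cancelʳ-≤; +-cancelˡ-≡; *-cancelˡ-≤; +-*-semiring; module ≤-Reasoning )
open import Algebra.Properties.Semiring.Sum +-*-semiring
  using (sum; ∑-distrib-+; ∑-comm; sum-cong-≗; sum-replicate-zero; *-distribˡ-sum)
open import Data.Product using (Σ; _×_; _,_; proj₁; proj₂)
open import Data.Sum using (_⊎_; inj₁; inj₂)
import Data.Sum as Sum
open import Data.Vec using (lookup; []; _∷_)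
open import Function using (_∘_; id; case_of_)
open import Function.Bundles using (Equivalence; Injection; mk↔ₛ′)
open import Function.Construct.Symmetry using (↔-sym)
open import Function.Properties.Inverse using (↔⇒↣)
open import Relation.Binary.Construct.Closure.ReflexiveTransitive using (Star; ε; _◅_)
open import Relation.Binary.PropositionalEquality
  using (_≡_; _≢_; refl; sym; trans; cong; cong₂; subst; ≢-sym; module ≡-Reasoning)
open import Relation.Nullary using (¬_; yes; no; does; contradiction; ¬?; _×-dec_)
open import Relation.Nullary.Decidable
  using (Dec; True; toWitness; from-yes; ⌊_⌋; _→-dec_; _⊎-dec_)

_∖_ : ∀ {n} → (Fin n → Bool) → Fin n → Fin n → Bool
(p ∖ a) x = p x ∧ not (does (x ≟ a))

∖-true⁺ : ∀ {n} {p : Fin n → Bool} {a x} → p x ≡ true → x ≢ a → (p ∖ a) x ≡ true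
∖-true⁺ {a = a} {x} px x≢a with x ≟ a
... | yes x≡a = contradiction x≡a x≢a
... | no _    = trans (∧-identityʳ _) px

∖-true⁻ : ∀ {n} {p : Fin n → Bool} {a x} → (p ∖ a) x ≡ true → p x ≡ true × x ≢ a
∖-true⁻ {p = p} {a} {x} e with p x | x ≟ a
... | true | no x≢a = refl , x≢a

countᵇ-cong : ∀ {n} {p q : Fin n → Bool} → (∀ i → p i ≡ q i) → countᵇ p ≡ countᵇ q
countᵇ-cong {zero}  _   = refl
countᵇ-cong {suc n} p≗q rewrite p≗q zero = cong (_ +_) (countᵇ-cong (p≗q ∘ suc))

countᵇ-remove : ∀ {n} (p : Fin n → Bool) {a} → p a ≡ true → countᵇ p ≡ suc (countᵇ (p ∖ a))
countᵇ-remove {suc n} p {zero} pa rewrite pa = cong suc (countᵇ-cong λ i → sym (∧-identityʳ (p (suc i))))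
countᵇ-remove {suc n} p {suc a} pa with p zero
... | true  = cong suc (countᵇ-remove (p ∘ suc) pa)
... | false = countᵇ-remove (p ∘ suc) pa

countᵇ-false : ∀ {n} (p : Fin n → Bool) → (∀ i → p i ≡ false) → countᵇ p ≡ 0
countᵇ-false {zero}  p _ = refl
countᵇ-false {suc n} p p≗false rewrite p≗false zero = countᵇ-false (p ∘ suc) (p≗false ∘ suc)

countᵇ≤length : ∀ {n} (p : Fin n → Bool) (xs : List (Fin n)) →
                (∀ x → p x ≡ true → x ∈ xs) → countᵇ p ≤ length xs
countᵇ≤length p [] covered = ≤-reflexive (countᵇ-false p uncovered)
  where
  uncovered : ∀ x → p x ≡ false
  uncovered x with p x in px
  ... | false = refl
  ... | true with () ← covered x px
countᵇ≤length p (a ∷ xs) covered with p a in pa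
... | true  = ≤-trans (≤-reflexive (countᵇ-remove p pa)) (s≤s (countᵇ≤length (p ∖ a) xs covered′))
  where
  covered′ : ∀ x → (p ∖ a) x ≡ true → x ∈ xs
  covered′ x e with ∖-true⁻ {p = p} e
  ... | px , x≢a with covered x px
  ...   | here x≡a  = contradiction x≡a x≢a
  ...   | there x∈xs = x∈xs
... | false = m≤n⇒m≤1+n (countᵇ≤length p xs covered′)
  where
  covered′ : ∀ x → p x ≡ true → x ∈ xs
  covered′ x px with covered x px
  ... | here refl  with () ← trans (sym px) pa
  ... | there x∈xs = x∈xs

length≤countᵇ : ∀ {n} (p : Fin n → Bool) {xs : List (Fin n)} →
                Unique xs → All (λ x → p x ≡ true) xs → length xs ≤ countᵇ p
length≤countᵇ p [] [] = z≤n
length≤countᵇ p {a ∷ xs} (a∉xs ∷ unique) (pa ∷ pxs) =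
  ≤-trans (s≤s (length≤countᵇ (p ∖ a) unique pxs∖a)) (≤-reflexive (sym (countᵇ-remove p pa)))
  where
  pxs∖a = All.zipWith (λ (a≢x , px) → ∖-true⁺ {p = p} px (a≢x ∘ sym)) (a∉xs , pxs)

record Triple {n} (p : Fin n → Bool) : Set where
  constructor triple
  field
    {x y z} : Fin n
    x≢y : x ≢ y
    x≢z : x ≢ z
    y≢z : y ≢ z
    px  : p x ≡ true
    py  : p y ≡ true
    pz  : p z ≡ true

module _ {n} {p : Fin n → Bool} (count≡3 : countᵇ p ≡ 3) where

  triple-exhaustive : (t : Triple p) → let open Triple t in
                      ∀ {w} → p w ≡ true → w ≡ x ⊎ w ≡ y ⊎ w ≡ z
  triple-exhaustive (triple {x} {y} {z} x≢y x≢z y≢z px py pz) {w} pw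
    with w ≟ x | w ≟ y | w ≟ z
  ... | yes w≡x | _       | _       = inj₁ w≡x
  ... | no _    | yes w≡y | _       = inj₂ (inj₁ w≡y)
  ... | no _    | no _    | yes w≡z = inj₂ (inj₂ w≡z)
  ... | no w≢x  | no w≢y  | no w≢z  = contradiction (≤-trans four≤count (≤-reflexive count≡3)) (<-irrefl refl)
    where
    four≤count : 4 ≤ countᵇ p
    four≤count = length≤countᵇ p
      ((w≢x ∷ w≢y ∷ w≢z ∷ []) ∷ (x≢y ∷ x≢z ∷ []) ∷ (y≢z ∷ []) ∷ [] ∷ [])
      (pw ∷ px ∷ py ∷ pz ∷ [])

  another-true : ∀ a b → Σ (Fin n) λ r → p r ≡ true × r ≢ a × r ≢ b
  another-true a b with any? (λ r → (p r Bool.≟ true) ×-dec ¬? (r ≟ a) ×-dec ¬? (r ≟ b))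
  ... | yes found = found
  ... | no none =
    contradiction (≤-trans (≤-reflexive (sym count≡3)) (countᵇ≤length p (a ∷ b ∷ []) covered)) (<-irrefl refl)
    where
    covered : ∀ r → p r ≡ true → r ∈ a ∷ b ∷ []
    covered r pr with r ≟ a | r ≟ b
    ... | yes r≡a | _       = here r≡a
    ... | no _    | yes r≡b = there (here r≡b)
    ... | no r≢a  | no r≢b  = contradiction (r , pr , r≢a , r≢b) none

  triple-from : Fin n → Triple p
  triple-from seed with another-true seed seed
  ... | x , px , _ with another-true x x
  ... | y , py , y≢x , _ with another-true x y
  ... | z , pz , z≢x , z≢y = triple (y≢x ∘ sym) (z≢x ∘ sym) (z≢y ∘ sym) px py pz

⟦_⟧ : Bool → ℕ
⟦ b ⟧ = if b then 1 else 0

countᵇ≡sum : ∀ {n} (p : Fin n → Bool) → countᵇ p ≡ sum (λ i → ⟦ p i ⟧)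
countᵇ≡sum {zero}  p = refl
countᵇ≡sum {suc n} p = cong (⟦ p zero ⟧ +_) (countᵇ≡sum (p ∘ suc))

sum-zero : ∀ {n} {f : Fin n → ℕ} → (∀ i → f i ≡ 0) → sum f ≡ 0
sum-zero {n} f≗0 = trans (sum-cong-≗ f≗0) (sum-replicate-zero n)

sum-mono-≤ : ∀ {n} {f g : Fin n → ℕ} → (∀ i → f i ≤ g i) → sum f ≤ sum g
sum-mono-≤ {zero}  f≤g = z≤n
sum-mono-≤ {suc n} f≤g = +-mono-≤ (f≤g zero) (sum-mono-≤ (f≤g ∘ suc))

≤-sum : ∀ {n} (f : Fin n → ℕ) k → f k ≤ sum f
≤-sum f zero    = m≤m+n _ _
≤-sum f (suc k) = ≤-trans (≤-sum (f ∘ suc) k) (m≤n+m _ _)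

sum-mono-< : ∀ {n} {f g : Fin n → ℕ} → (∀ i → f i ≤ g i) → ∀ k → f k < g k → sum f < sum g
sum-mono-< f≤g zero    fk<gk = +-mono-<-≤ fk<gk (sum-mono-≤ (f≤g ∘ suc))
sum-mono-< f≤g (suc k) fk<gk = +-mono-≤-< (f≤g zero) (sum-mono-< (f≤g ∘ suc) k fk<gk)

sum-mono-<₂ : ∀ {n} {f g : Fin n → ℕ} → (∀ i → f i ≤ g i) →
              ∀ {k l} → k ≢ l → f k < g k → f l < g l → 2 + sum f ≤ sum g
sum-mono-<₂ f≤g {zero} {zero} k≢l _ _ = contradiction refl k≢l
sum-mono-<₂ {f = f} f≤g {zero}  {suc l} _ fk<gk fl<gl =
  ≤-trans (≤-reflexive (cong suc (sym (+-suc (f zero) _))))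
          (+-mono-≤ fk<gk (sum-mono-< (f≤g ∘ suc) l fl<gl))
sum-mono-<₂ {f = f} f≤g {suc k} {zero}  _ fk<gk fl<gl =
  ≤-trans (≤-reflexive (cong suc (sym (+-suc (f zero) _))))
          (+-mono-≤ fl<gl (sum-mono-< (f≤g ∘ suc) k fk<gk))
sum-mono-<₂ {f = f} f≤g {suc k} {suc l} k≢l fk<gk fl<gl =
  ≤-trans (≤-reflexive (sym (trans (+-suc (f zero) _) (cong suc (+-suc (f zero) _)))))
          (+-mono-≤ (f≤g zero) (sum-mono-<₂ (f≤g ∘ suc) (k≢l ∘ cong suc) fk<gk fl<gl))

sum-tight : ∀ {n} {f g : Fin n → ℕ} → (∀ i → f i ≤ g i) → sum g ≤ sum f → ∀ i → f i ≡ g i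
sum-tight {suc n} {f} {g} f≤g sum-g≤sum-f = λ where
    zero    → ≤-antisym (f≤g zero) head-g≤head-f
    (suc i) → sum-tight (f≤g ∘ suc) tail-g≤tail-f i
  where
  head-g≤head-f : g zero ≤ f zero
  head-g≤head-f = +-cancelʳ-≤ _ _ _ (≤-trans sum-g≤sum-f (+-monoʳ-≤ (f zero) (sum-mono-≤ (f≤g ∘ suc))))
  tail-g≤tail-f : sum (g ∘ suc) ≤ sum (f ∘ suc)
  tail-g≤tail-f = +-cancelˡ-≤ (g zero) _ _ (≤-trans sum-g≤sum-f (+-monoˡ-≤ _ (f≤g zero)))

InRegular3 : ∀ {n} → Digraph n → Set
InRegular3 G = ∀ v → countᵇ (λ u → arc G u v) ≡ 3

module Counting {n} (G : Digraph n) (reg : OutRegular3 G) (dom : Dominated G) (no2 : No2Cycle G) where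

  χ : Fin n → Fin n → ℕ
  χ u v = ⟦ arc G u v ⟧

  inside : Fin n → Fin n → Fin n → ℕ
  inside w u v = ⟦ arc G w u ∧ arc G w v ∧ arc G u v ⟧

  arcsInside : Fin n → ℕ
  arcsInside w = sum λ u → sum λ v → inside w u v

  incidentInside : Fin n → Fin n → ℕ
  incidentInside w u = sum λ v → inside w u v + inside w v u

  outdegree≡3 : ∀ u → sum (χ u) ≡ 3
  outdegree≡3 u = trans (sym (countᵇ≡sum (arc G u))) (reg u)

  incident-pair≤ : ∀ {w u} v → arc G w u ≡ true → inside w u v + inside w v u ≤ χ w v
  incident-pair≤ {w} {u} v wu with arc G w u | arc G w v | arc G u v in uv | arc G v u in vu
  ... | true | false | _     | _     = z≤n
  ... | true | true  | false | false = z≤n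
  ... | true | true  | true  | false = ≤-refl
  ... | true | true  | false | true  = ≤-refl
  ... | true | true  | true  | true  = contradiction vu (no2 u v uv)

  incident-pair≡0 : ∀ {w u} v → arc G w u ≡ false → inside w u v + inside w v u ≡ 0
  incident-pair≡0 {w} {u} v wu with arc G w u | arc G w v
  ... | false | false = refl
  ... | false | true  = refl

  incident-self< : ∀ {w u} → arc G w u ≡ true → inside w u u + inside w u u < χ w u
  incident-self< {w} {u} wu rewrite noLoop G u | wu = s≤s z≤n

  incident≤2 : ∀ w u → incidentInside w u ≤ 2 * χ w u
  incident≤2 w u = by-cases (arc G w u) refl
    where
    by-cases : ∀ b → arc G w u ≡ b → incidentInside w u ≤ 2 * ⟦ b ⟧
    by-cases false wu = ≤-reflexive (sum-zero λ v → incident-pair≡0 v wu)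
    by-cases true  wu = ≤-pred (begin-strict
      incidentInside w u  <⟨ sum-mono-< (λ v → incident-pair≤ v wu) u (incident-self< wu) ⟩
      sum (χ w)           ≡⟨ outdegree≡3 w ⟩
      3                   ∎)
      where open ≤-Reasoning

  twice-arcsInside : ∀ w → 2 * arcsInside w ≡ sum (incidentInside w)
  twice-arcsInside w = begin
    2 * D
      ≡⟨ cong (D +_) (+-identityʳ D) ⟩
    D + D
      ≡⟨ cong (D +_) (∑-comm (inside w)) ⟩
    D + (sum λ u → sum λ v → inside w v u)
      ≡⟨ ∑-distrib-+ (λ u → sum λ v → inside w u v) _ ⟨
    (sum λ u → (sum λ v → inside w u v) + (sum λ v → inside w v u))
      ≡⟨ sum-cong-≗ (λ u → ∑-distrib-+ (λ v → inside w u v) _) ⟨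
    sum (incidentInside w)
      ∎
    where
    open ≡-Reasoning
    D = arcsInside w

  sum-twice-outdegree : ∀ w → (sum λ u → 2 * χ w u) ≡ 2 * 3
  sum-twice-outdegree w = trans (sym (*-distribˡ-sum 2 (χ w))) (cong (2 *_) (outdegree≡3 w))

  arcsInside≤3 : ∀ w → arcsInside w ≤ 3
  arcsInside≤3 w = *-cancelˡ-≤ 2 (begin
    2 * arcsInside w           ≡⟨ twice-arcsInside w ⟩
    sum (incidentInside w)     ≤⟨ sum-mono-≤ (incident≤2 w) ⟩
    (sum λ u → 2 * χ w u)      ≡⟨ sum-twice-outdegree w ⟩
    2 * 3                      ∎)
    where open ≤-Reasoning

  dominators : Fin n → Fin n → ℕ
  dominators u v = sum λ w → inside w u v

  arc≤dominators : ∀ u v → χ u v ≤ dominators u v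
  arc≤dominators u v with arc G u v in uv
  ... | false = z≤n
  ... | true with dom u v uv
  ...   | w , wu , wv = ≤-trans (≤-reflexive (sym one)) (≤-sum _ w)
    where
    one : ⟦ arc G w u ∧ arc G w v ∧ true ⟧ ≡ 1
    one rewrite wu | wv = refl

  all-dominators : (sum λ u → sum (dominators u)) ≡ sum arcsInside
  all-dominators = trans (sum-cong-≗ λ u → ∑-comm λ v w → inside w u v)
                         (∑-comm λ u w → sum λ v → inside w u v)

  all-arcs≡3n : (sum λ u → sum (χ u)) ≡ sum {n} (λ _ → 3)
  all-arcs≡3n = sum-cong-≗ outdegree≡3

  arcsInside≡3 : ∀ w → arcsInside w ≡ 3
  arcsInside≡3 = sum-tight arcsInside≤3 (begin
    sum {n} (λ _ → 3)               ≡⟨ all-arcs≡3n ⟨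
    (sum λ u → sum (χ u))           ≤⟨ sum-mono-≤ (λ u → sum-mono-≤ (arc≤dominators u)) ⟩
    (sum λ u → sum (dominators u))  ≡⟨ all-dominators ⟩
    sum arcsInside                  ∎)
    where open ≤-Reasoning

  arc≡dominators : ∀ u v → χ u v ≡ dominators u v
  arc≡dominators u = sum-tight (arc≤dominators u) (≤-reflexive (sym (row-tight u)))
    where
    row-tight : ∀ u → sum (χ u) ≡ sum (dominators u)
    row-tight = sum-tight (λ u → sum-mono-≤ (arc≤dominators u)) (≤-reflexive (begin
      (sum λ u → sum (dominators u))  ≡⟨ all-dominators ⟩
      sum arcsInside                  ≡⟨ sum-cong-≗ arcsInside≡3 ⟩
      sum {n} (λ _ → 3)               ≡⟨ all-arcs≡3n ⟨
      (sum λ u → sum (χ u))           ∎))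
      where open ≡-Reasoning

  incident≡2 : ∀ w u → incidentInside w u ≡ 2 * χ w u
  incident≡2 w = sum-tight (incident≤2 w) (≤-reflexive (begin
    (sum λ u → 2 * χ w u)   ≡⟨ sum-twice-outdegree w ⟩
    2 * 3                   ≡⟨ cong (2 *_) (arcsInside≡3 w) ⟨
    2 * arcsInside w        ≡⟨ twice-arcsInside w ⟩
    sum (incidentInside w)  ∎))
    where open ≡-Reasoning

  -- Count the arcs at v by their unique dominators w: each predecessor w of v sees exactly two
  -- of them among its successors, so in-degree + 3 = 2 · in-degree.
  indegree≡3 : InRegular3 G
  indegree≡3 v = trans (countᵇ≡sum (λ u → arc G u v))
                       (sym (+-cancelˡ-≡ I 3 I (trans (sym degree≡I+3) degree≡I+I)))
    where
    open ≡-Reasoning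
    I = sum λ u → χ u v
    degree≡I+3 : (sum λ u → χ u v + χ v u) ≡ I + 3
    degree≡I+3 = trans (∑-distrib-+ (λ u → χ u v) (χ v)) (cong (I +_) (outdegree≡3 v))
    degree≡I+I : (sum λ u → χ u v + χ v u) ≡ I + I
    degree≡I+I = begin
      (sum λ u → χ u v + χ v u)
        ≡⟨ sum-cong-≗ (λ u → cong₂ _+_ (arc≡dominators u v) (arc≡dominators v u)) ⟩
      (sum λ u → dominators u v + dominators v u)
        ≡⟨ sum-cong-≗ (λ u → ∑-distrib-+ (λ w → inside w u v) _) ⟨
      (sum λ u → sum λ w → inside w u v + inside w v u)
        ≡⟨ ∑-comm (λ u w → inside w u v + inside w v u) ⟩
      (sum λ w → sum λ u → inside w u v + inside w v u)
        ≡⟨ sum-cong-≗ (λ w → sum-cong-≗ λ u → +-comm (inside w u v) _) ⟩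
      (sum λ w → incidentInside w v)
        ≡⟨ sum-cong-≗ (λ w → incident≡2 w v) ⟩
      (sum λ w → 2 * χ w v)
        ≡⟨ *-distribˡ-sum 2 (λ w → χ w v) ⟨
      2 * I
        ≡⟨ cong (I +_) (+-identityʳ I) ⟩
      I + I
        ∎

  successors-adjacent : ∀ {w u v} → arc G w u ≡ true → arc G w v ≡ true → u ≢ v →
                        arc G u v ≡ true ⊎ arc G v u ≡ true
  successors-adjacent {w} {u} {v} wu wv u≢v with arc G u v in uv | arc G v u in vu
  ... | true  | _     = inj₁ refl
  ... | false | true  = inj₂ refl
  ... | false | false = contradiction (begin
    2 + 2                         ≡⟨ cong (λ b → 2 + 2 * ⟦ b ⟧) wu ⟨
    2 + 2 * χ w u                 ≡⟨ cong (2 +_) (incident≡2 w u) ⟨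
    2 + incidentInside w u        ≤⟨ sum-mono-<₂ (λ x → incident-pair≤ x wu) u≢v (incident-self< wu) other< ⟩
    sum (χ w)                     ≡⟨ outdegree≡3 w ⟩
    3                             ∎) (<-irrefl refl)
    where
    open ≤-Reasoning
    other< : inside w u v + inside w v u < χ w v
    other< rewrite wu | wv | uv | vu = s≤s z≤n

IsHomomorphism : ∀ {m n} → Digraph m → Digraph n → (Fin m → Fin n) → Set
IsHomomorphism H G φ = ∀ i j → arc H i j ≡ true → arc G (φ i) (φ j) ≡ true

Homomorphism : ∀ {m n} → Digraph m → Digraph n → Set
Homomorphism {m} {n} H G = Σ (Fin m → Fin n) (IsHomomorphism H G)

Near : ∀ {m} → Digraph m → Fin m → Fin m → Set
Near {m} H j k = arc H j k ≡ true ⊎ arc H k j ≡ true ⊎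
                 Σ (Fin m) λ l → arc H j l ≡ true × arc H l k ≡ true

AllNear : ∀ {m} → Digraph m → Set
AllNear H = ∀ j k → j ≢ k → Near H j k

near⇒connected : ∀ {m} {H : Digraph m} → AllNear H → WeaklyConnected H
near⇒connected near j k with j ≟ k
... | yes refl = ε
... | no j≢k with near j k j≢k
...   | inj₁ jk                   = inj₁ jk ◅ ε
...   | inj₂ (inj₁ kj)            = inj₂ kj ◅ ε
...   | inj₂ (inj₂ (l , jl , lk)) = inj₁ jl ◅ inj₁ lk ◅ ε

arcFromSuccessors : ∀ {m} → (Fin m → List (Fin m)) → Fin m → Fin m → Bool
arcFromSuccessors N⁺ u v = any (λ x → ⌊ x ≟ v ⌋) (N⁺ u)

arcFromSuccessors⇒∈ : ∀ {m} (N⁺ : Fin m → List (Fin m)) {u v} →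
                      arcFromSuccessors N⁺ u v ≡ true → v ∈ N⁺ u
arcFromSuccessors⇒∈ N⁺ {u} {v} uv =
  Any.map (λ {x} x≡v → sym (toWitness {a? = x ≟ v} x≡v))
          (any⁻ (λ x → ⌊ x ≟ v ⌋) (N⁺ u) (Equivalence.from T-≡ uv))

homomorphism-from-successors :
  ∀ {m n} (N⁺ : Fin m → List (Fin m)) {G : Digraph n} (φ : Fin m → Fin n) →
  (∀ i → All (λ j → arc G (φ i) (φ j) ≡ true) (N⁺ i)) →
  ∀ i j → arcFromSuccessors N⁺ i j ≡ true → arc G (φ i) (φ j) ≡ true
homomorphism-from-successors N⁺ φ images i j ij = All.lookup (images i) (arcFromSuccessors⇒∈ N⁺ ij)

fromSuccessors : ∀ {m} (N⁺ : Fin m → List (Fin m)) →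
                 {True (all? λ u → arcFromSuccessors N⁺ u u Bool.≟ false)} → Digraph m
fromSuccessors N⁺ {loopless} = record { arc = arcFromSuccessors N⁺ ; noLoop = toWitness loopless }

Certificate : ∀ {m} → Digraph m → Set
Certificate H = OutRegular3 H × InRegular3 H × Dominated H × No2Cycle H × AllNear H

certificate? : ∀ {m} (H : Digraph m) → Dec (Certificate H)
certificate? H =
  (all? λ u → outDeg H u ℕ.≟ 3) ×-dec
  (all? λ v → countᵇ (λ u → arc H u v) ℕ.≟ 3) ×-dec
  (all? λ u → all? λ v → u ⟶? v →-dec any? λ w → w ⟶? u ×-dec w ⟶? v) ×-dec
  (all? λ u → all? λ v → u ⟶? v →-dec ¬? (v ⟶? u)) ×-dec
  (all? λ j → all? λ k → ¬? (j ≟ k) →-dec (j ⟶? k ⊎-dec k ⟶? j ⊎-dec any? λ l → j ⟶? l ×-dec l ⟶? k))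
  where
  _⟶?_ : ∀ u v → Dec (arc H u v ≡ true)
  u ⟶? v = arc H u v Bool.≟ true

certified⇒good : ∀ {m} {H : Digraph (suc m)} → Certificate H → Good H
certified⇒good {H = H} (out , _ , dom , no2 , near) = s≤s z≤n , out , dom , no2 , near⇒connected {H = H} near

-- Up to relabelling, H₇ is the quadratic-residue tournament on ℤ₇, and H₈ is an orientation
-- of K₈ minus the perfect matching {07, 16, 24, 35}.
successors₇ : Fin 7 → List (Fin 7)
successors₇ 0F = 1F ∷ 2F ∷ 3F ∷ []
successors₇ 1F = 2F ∷ 5F ∷ 6F ∷ []
successors₇ 2F = 3F ∷ 4F ∷ 6F ∷ []
successors₇ 3F = 1F ∷ 4F ∷ 5F ∷ []
successors₇ 4F = 0F ∷ 1F ∷ 6F ∷ []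
successors₇ 5F = 0F ∷ 2F ∷ 4F ∷ []
successors₇ 6F = 0F ∷ 3F ∷ 5F ∷ []

successors₈ : Fin 8 → List (Fin 8)
successors₈ 0F = 1F ∷ 2F ∷ 3F ∷ []
successors₈ 1F = 2F ∷ 5F ∷ 7F ∷ []
successors₈ 2F = 3F ∷ 6F ∷ 7F ∷ []
successors₈ 3F = 1F ∷ 4F ∷ 7F ∷ []
successors₈ 4F = 0F ∷ 1F ∷ 5F ∷ []
successors₈ 5F = 0F ∷ 2F ∷ 6F ∷ []
successors₈ 6F = 0F ∷ 3F ∷ 4F ∷ []
successors₈ 7F = 4F ∷ 5F ∷ 6F ∷ []

H₇ : Digraph 7
H₇ = fromSuccessors successors₇

H₈ : Digraph 8
H₈ = fromSuccessors successors₈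

certificate₇ : Certificate H₇
certificate₇ = from-yes (certificate? H₇)

certificate₈ : Certificate H₈
certificate₈ = from-yes (certificate? H₈)

module Structure {n} (G : Digraph n) (reg : OutRegular3 G) (dom : Dominated G) (no2 : No2Cycle G) where
  open Counting G reg dom no2 using (indegree≡3; successors-adjacent)

  infix 4 _⟶_
  _⟶_ : Fin n → Fin n → Set
  u ⟶ v = arc G u v ≡ true

  ⟶-irrefl : ∀ {u} → ¬ u ⟶ u
  ⟶-irrefl {u} uu with () ← trans (sym (noLoop G u)) uu

  ⟶-asym : ∀ {u v} → u ⟶ v → ¬ v ⟶ u
  ⟶-asym = no2 _ _

  ⟶⇒≢ : ∀ {u v} → u ⟶ v → u ≢ v
  ⟶⇒≢ uv refl = ⟶-irrefl uv

  successor-among : ∀ {u p q r} → p ≢ q → p ≢ r → q ≢ r → u ⟶ p → u ⟶ q → u ⟶ r →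
                    ∀ {x} → u ⟶ x → x ≡ p ⊎ x ≡ q ⊎ x ≡ r
  successor-among {u} p≢q p≢r q≢r up uq ur =
    triple-exhaustive (reg u) (triple p≢q p≢r q≢r up uq ur)

  predecessor-among : ∀ {u p q r} → p ≢ q → p ≢ r → q ≢ r → p ⟶ u → q ⟶ u → r ⟶ u →
                      ∀ {x} → x ⟶ u → x ≡ p ⊎ x ≡ q ⊎ x ≡ r
  predecessor-among {u} p≢q p≢r q≢r pu qu ru =
    triple-exhaustive (indegree≡3 u) (triple p≢q p≢r q≢r pu qu ru)

  another-successor : ∀ u p q → Σ (Fin n) λ r → u ⟶ r × r ≢ p × r ≢ q
  another-successor u = another-true (reg u)

  -- The dominator of w ⟶ r would be a predecessor of r other than w, p, q.
  no-transitive-successors : ∀ {w p q r} → w ⟶ p → w ⟶ q → w ⟶ r → p ⟶ q → p ⟶ r → q ⟶ r → ⊥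
  no-transitive-successors wp wq wr pq pr qr with dom _ _ wr
  ... | z , zw , zr with predecessor-among (⟶⇒≢ wp) (⟶⇒≢ wq) (⟶⇒≢ pq) wr pr qr zr
  ...   | inj₁ refl        = ⟶-irrefl zw
  ...   | inj₂ (inj₁ refl) = ⟶-asym wp zw
  ...   | inj₂ (inj₂ refl) = ⟶-asym wq zw

  closing-triangle : ∀ {w p q} → w ⟶ p → w ⟶ q → p ⟶ q → Σ (Fin n) λ r → w ⟶ r × q ⟶ r × r ⟶ p
  closing-triangle {w} {p} {q} wp wq pq with another-successor w p q
  ... | r , wr , r≢p , r≢q with successors-adjacent wq wr (≢-sym r≢q) | successors-adjacent wp wr (≢-sym r≢p)
  ...   | inj₁ qr | inj₂ rp = r , wr , qr , rp
  ...   | inj₁ qr | inj₁ pr = ⊥-elim (no-transitive-successors wp wq wr pq pr qr)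
  ...   | inj₂ rq | inj₂ rp = ⊥-elim (no-transitive-successors wr wp wq rp rq pq)
  ...   | inj₂ rq | inj₁ pr = ⊥-elim (no-transitive-successors wp wr wq pr pq rq)

  cyclic-successors : ∀ v → Σ (Fin n) λ a → Σ (Fin n) λ b → Σ (Fin n) λ c →
                      v ⟶ a × v ⟶ b × v ⟶ c × a ⟶ b × b ⟶ c × c ⟶ a
  cyclic-successors v with another-successor v v v
  ... | a , va , _ with another-successor v a a
  ...   | b , vb , b≢a , _ with successors-adjacent va vb (≢-sym b≢a)
  ...     | inj₁ ab with closing-triangle va vb ab
  ...       | c , vc , bc , ca = a , b , c , va , vb , vc , ab , bc , ca
  cyclic-successors v | a , va , _ | b , vb , b≢a , _ | inj₂ ba with closing-triangle vb va ba
  ...       | c , vc , ac , cb = b , a , c , vb , va , vc , ba , ac , cb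

  record Frame : Set where
    constructor frame
    field
      {v a b c w x y} : Fin n
      va : v ⟶ a
      vb : v ⟶ b
      vc : v ⟶ c
      ab : a ⟶ b
      bc : b ⟶ c
      ca : c ⟶ a
      wv : w ⟶ v
      wa : w ⟶ a
      xv : x ⟶ v
      xb : x ⟶ b
      yv : y ⟶ v
      yc : y ⟶ c

  H₈-case : (F : Frame) → let open Frame F in
            w ⟶ x → a ⟶ x → x ⟶ y → b ⟶ y → y ⟶ w → c ⟶ w → Homomorphism H₈ G
  H₈-case (frame {v} {a} {b} {c} {w} {x} {y} va vb vc ab bc ca wv wa xv xb yv yc) wx ax xy by yw cw
    with closing-triangle ax ab xb | closing-triangle by bc yc | closing-triangle cw ca wa
  ... | z , az , bz , zx | z′ , bz′ , cz′ , z′y | z″ , cz″ , az″ , z″w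
    with successor-among (≢-sym (⟶⇒≢ xb)) (⟶⇒≢ bz) (≢-sym (⟶⇒≢ zx)) ab ax az az″
       | successor-among (≢-sym (⟶⇒≢ yc)) (⟶⇒≢ cz′) (≢-sym (⟶⇒≢ z′y)) bc by bz′ bz
  ... | inj₁ refl        | _                = ⊥-elim (⟶-asym bc cz″)
  ... | inj₂ (inj₁ refl) | _                = ⊥-elim (⟶-asym wx z″w)
  ... | inj₂ (inj₂ refl) | inj₁ refl        = ⊥-elim (⟶-asym az ca)
  ... | inj₂ (inj₂ refl) | inj₂ (inj₁ refl) = ⊥-elim (⟶-asym xy zx)
  ... | inj₂ (inj₂ refl) | inj₂ (inj₂ refl) = φ , homomorphism-from-successors successors₈ {G} φ λ where
      0F → va ∷ vb ∷ vc ∷ []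
      1F → ab ∷ ax ∷ az ∷ []
      2F → bc ∷ by ∷ bz ∷ []
      3F → ca ∷ cw ∷ cz″ ∷ []
      4F → wv ∷ wa ∷ wx ∷ []
      5F → xv ∷ xb ∷ xy ∷ []
      6F → yv ∷ yc ∷ yw ∷ []
      7F → z″w ∷ zx ∷ z′y ∷ []
    where
    φ : Fin 8 → Fin n
    φ = lookup (v ∷ a ∷ b ∷ c ∷ w ∷ x ∷ y ∷ z ∷ [])

  H₇-case : (F : Frame) → let open Frame F in
            w ⟶ y → a ⟶ y → x ⟶ w → b ⟶ w → y ⟶ x → c ⟶ x → Homomorphism H₇ G
  H₇-case (frame {v} {a} {b} {c} {w} {x} {y} va vb vc ab bc ca wv wa xv xb yv yc) wy ay xw bw yx cx
    with successors-adjacent ab ay (λ { refl → ⟶-asym vb yv })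
  ... | inj₂ yb with successor-among (⟶⇒≢ vc) (≢-sym (⟶⇒≢ xv)) (⟶⇒≢ cx) yv yc yx yb
  ...   | inj₁ refl        = ⊥-elim (⟶-irrefl vb)
  ...   | inj₂ (inj₁ refl) = ⊥-elim (⟶-irrefl bc)
  ...   | inj₂ (inj₂ refl) = ⊥-elim (⟶-irrefl xb)
  H₇-case (frame va vb vc ab bc ca wv wa xv xb yv yc) wy ay xw bw yx cx | inj₁ by
    with successors-adjacent bc bw (λ { refl → ⟶-asym vc wv })
  ... | inj₂ wc with successor-among (⟶⇒≢ va) (≢-sym (⟶⇒≢ yv)) (⟶⇒≢ ay) wv wa wy wc
  ...   | inj₁ refl        = ⊥-elim (⟶-irrefl vc)
  ...   | inj₂ (inj₁ refl) = ⊥-elim (⟶-irrefl ca)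
  ...   | inj₂ (inj₂ refl) = ⊥-elim (⟶-irrefl yc)
  H₇-case (frame {v} {a} {b} {c} {w} {x} {y} va vb vc ab bc ca wv wa xv xb yv yc) wy ay xw bw yx cx | inj₁ by | inj₁ cw
    with closing-triangle ab ay by
  ... | r , ar , yr , rb with successor-among (⟶⇒≢ vc) (≢-sym (⟶⇒≢ xv)) (⟶⇒≢ cx) yv yc yx yr
  ...   | inj₁ refl        = ⊥-elim (⟶-asym va ar)
  ...   | inj₂ (inj₁ refl) = ⊥-elim (⟶-asym bc rb)
  ...   | inj₂ (inj₂ refl) = φ , homomorphism-from-successors successors₇ {G} φ λ where
      0F → va ∷ vb ∷ vc ∷ []
      1F → ab ∷ ar ∷ ay ∷ []
      2F → bc ∷ bw ∷ by ∷ []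
      3F → ca ∷ cw ∷ cx ∷ []
      4F → wv ∷ wa ∷ wy ∷ []
      5F → xv ∷ xb ∷ xw ∷ []
      6F → yv ∷ yc ∷ yx ∷ []
    where
    φ : Fin 7 → Fin n
    φ = lookup (v ∷ a ∷ b ∷ c ∷ w ∷ x ∷ y ∷ [])

  -- Closing the triangles on w ⟶ v, w ⟶ a (and likewise for x, y) yields predecessors
  -- z₁, z₂, z₃ of v, hence elements of {w, x, y}; only the two rotations survive.
  frame-embedding : (F : Frame) → let open Frame F in ∀ {z₁ z₂ z₃} →
                    w ⟶ z₁ → a ⟶ z₁ → z₁ ⟶ v →
                    x ⟶ z₂ → b ⟶ z₂ → z₂ ⟶ v →
                    y ⟶ z₃ → c ⟶ z₃ → z₃ ⟶ v →
                    Homomorphism H₇ G ⊎ Homomorphism H₈ G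
  frame-embedding F@(frame {v} {a} {b} {c} {w} {x} {y} va vb vc ab bc ca wv wa xv xb yv yc)
                  wz₁ az₁ z₁v xz₂ bz₂ z₂v yz₃ cz₃ z₃v
    with predecessor-among w≢x w≢y x≢y wv xv yv z₁v
       | predecessor-among w≢x w≢y x≢y wv xv yv z₂v
       | predecessor-among w≢x w≢y x≢y wv xv yv z₃v
    where
    w≢x : w ≢ x
    w≢x refl = no-transitive-successors wv wa xb va vb ab
    w≢y : w ≢ y
    w≢y refl = no-transitive-successors wv yc wa vc va ca
    x≢y : x ≢ y
    x≢y refl = no-transitive-successors xv xb yc vb vc bc
  ... | inj₁ refl        | _                | _                = ⊥-elim (⟶-irrefl wz₁)
  ... | _                | inj₂ (inj₁ refl) | _                = ⊥-elim (⟶-irrefl xz₂)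
  ... | _                | _                | inj₂ (inj₂ refl) = ⊥-elim (⟶-irrefl yz₃)
  ... | inj₂ (inj₁ refl) | inj₁ refl        | _                = ⊥-elim (⟶-asym wz₁ xz₂)
  ... | inj₂ (inj₁ refl) | inj₂ (inj₂ refl) | inj₂ (inj₁ refl) = ⊥-elim (⟶-asym xz₂ yz₃)
  ... | inj₂ (inj₁ refl) | inj₂ (inj₂ refl) | inj₁ refl        = inj₂ (H₈-case F wz₁ az₁ xz₂ bz₂ yz₃ cz₃)
  ... | inj₂ (inj₂ refl) | inj₁ refl        | inj₁ refl        = ⊥-elim (⟶-asym wz₁ yz₃)
  ... | inj₂ (inj₂ refl) | inj₁ refl        | inj₂ (inj₁ refl) = inj₁ (H₇-case F wz₁ az₁ xz₂ bz₂ yz₃ cz₃)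
  ... | inj₂ (inj₂ refl) | inj₂ (inj₂ refl) | inj₁ refl        = ⊥-elim (⟶-asym wz₁ yz₃)
  ... | inj₂ (inj₂ refl) | inj₂ (inj₂ refl) | inj₂ (inj₁ refl) = ⊥-elim (⟶-asym xz₂ yz₃)

  H₇-or-H₈ : Fin n → Homomorphism H₇ G ⊎ Homomorphism H₈ G
  H₇-or-H₈ v with cyclic-successors v
  ... | a , b , c , va , vb , vc , ab , bc , ca with dom v a va | dom v b vb | dom v c vc
  ... | w , wv , wa | x , xv , xb | y , yv , yc
    with closing-triangle wv wa va | closing-triangle xv xb vb | closing-triangle yv yc vc
  ... | z₁ , wz₁ , az₁ , z₁v | z₂ , xz₂ , bz₂ , z₂v | z₃ , yz₃ , cz₃ , z₃v =
    frame-embedding (frame va vb vc ab bc ca wv wa xv xb yv yc) wz₁ az₁ z₁v xz₂ bz₂ z₂v yz₃ cz₃ z₃v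

≡true-ext : ∀ {b c : Bool} → (b ≡ true → c ≡ true) → (c ≡ true → b ≡ true) → b ≡ c
≡true-ext {false} {false} _   _   = refl
≡true-ext {false} {true}  _   c⇒b = c⇒b refl
≡true-ext {true}  {false} b⇒c _   = sym (b⇒c refl)
≡true-ext {true}  {true}  _   _   = refl

module _ {m n} {φ : Fin (suc m) → Fin n} (φ-injective : ∀ {j k} → φ j ≡ φ k → j ≡ k) where

  map-triple : ∀ {p : Fin (suc m) → Bool} {q : Fin n → Bool} →
               (∀ {j} → p j ≡ true → q (φ j) ≡ true) → Triple p → Triple q
  map-triple p⇒q (triple x≢y x≢z y≢z px py pz) =
    triple (x≢y ∘ φ-injective) (x≢z ∘ φ-injective) (y≢z ∘ φ-injective) (p⇒q px) (p⇒q py) (p⇒q pz)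

  three-trues-reflected : ∀ {p : Fin (suc m) → Bool} {q : Fin n → Bool} →
                          countᵇ p ≡ 3 → countᵇ q ≡ 3 → (∀ {j} → p j ≡ true → q (φ j) ≡ true) →
                          ∀ {u} → q u ≡ true → Σ (Fin (suc m)) λ k → p k ≡ true × φ k ≡ u
  three-trues-reflected {p} {q} p≡3 q≡3 p⇒q {u} qu = among (triple-exhaustive q≡3 (map-triple p⇒q t) qu)
    where
    t : Triple p
    t = triple-from p≡3 zero
    open Triple t
    among : u ≡ φ x ⊎ u ≡ φ y ⊎ u ≡ φ z → Σ (Fin (suc m)) λ k → p k ≡ true × φ k ≡ u
    among (inj₁ u≡φx)        = x , px , sym u≡φx
    among (inj₂ (inj₁ u≡φy)) = y , py , sym u≡φy
    among (inj₂ (inj₂ u≡φz)) = z , pz , sym u≡φz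

module _ {m n} {H : Digraph (suc m)} {G : Digraph n}
         (outH : OutRegular3 H) (inH : InRegular3 H) (nearH : AllNear H)
         (outG : OutRegular3 G) (inG : InRegular3 G) (no2G : No2Cycle G) (connG : WeaklyConnected G)
         (φ : Fin (suc m) → Fin n) (hom : IsHomomorphism H G φ) where

  private
    no-loop : ∀ {u v} → u ≡ v → arc G u v ≡ true → ⊥
    no-loop {u} refl uu with () ← trans (sym (noLoop G u)) uu

  φ-injective : ∀ {j k} → φ j ≡ φ k → j ≡ k
  φ-injective {j} {k} φj≡φk with j ≟ k
  ... | yes j≡k = j≡k
  ... | no j≢k with nearH j k j≢k
  ...   | inj₁ jk                   = ⊥-elim (no-loop φj≡φk (hom j k jk))
  ...   | inj₂ (inj₁ kj)            = ⊥-elim (no-loop (sym φj≡φk) (hom k j kj))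
  ...   | inj₂ (inj₂ (l , jl , lk)) =
    ⊥-elim (no2G (φ j) (φ l) (hom j l jl) (subst (λ u → arc G (φ l) u ≡ true) (sym φj≡φk) (hom l k lk)))

  successor-reflected : ∀ i {u} → arc G (φ i) u ≡ true →
                        Σ (Fin (suc m)) λ k → arc H i k ≡ true × φ k ≡ u
  successor-reflected i = three-trues-reflected φ-injective {p = arc H i} {q = arc G (φ i)}
                                                (outH i) (outG (φ i)) (λ {j} → hom i j)

  predecessor-reflected : ∀ i {u} → arc G u (φ i) ≡ true →
                          Σ (Fin (suc m)) λ k → arc H k i ≡ true × φ k ≡ u
  predecessor-reflected i = three-trues-reflected φ-injective {p = λ j → arc H j i} {q = λ u → arc G u (φ i)}
                                                  (inH i) (inG (φ i)) (λ {j} → hom j i)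

  InImage : Fin n → Set
  InImage u = Σ (Fin (suc m)) λ k → φ k ≡ u

  InImage-step : ∀ {u v} → UAdj G u v → InImage u → InImage v
  InImage-step (inj₁ uv) (k , refl) = let k′ , _ , φk′≡v = successor-reflected k uv in k′ , φk′≡v
  InImage-step (inj₂ vu) (k , refl) = let k′ , _ , φk′≡v = predecessor-reflected k vu in k′ , φk′≡v

  φ-surjective : ∀ u → InImage u
  φ-surjective u = along (connG (φ zero) u) (zero , refl)
    where
    along : ∀ {u v} → Star (UAdj G) u v → InImage u → InImage v
    along ε          = id
    along (s ◅ path) = along path ∘ InImage-step s

  arc-reflected : ∀ i j → arc G (φ i) (φ j) ≡ arc H i j
  arc-reflected i j = ≡true-ext reflect (hom i j)
    where
    reflect : arc G (φ i) (φ j) ≡ true → arc H i j ≡ true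
    reflect φiφj = let k , ik , φk≡φj = successor-reflected i φiφj in
                   subst (λ l → arc H i l ≡ true) (φ-injective φk≡φj) ik

  homomorphism⇒iso : Iso G H
  homomorphism⇒iso = mk↔ₛ′ ψ φ (λ k → φ-injective (proj₂ (φ-surjective (φ k)))) (proj₂ ∘ φ-surjective)
                   , λ u v → trans (cong₂ (arc G) (sym (proj₂ (φ-surjective u))) (sym (proj₂ (φ-surjective v))))
                                   (arc-reflected (ψ u) (ψ v))
    where
    ψ : Fin n → Fin (suc m)
    ψ = proj₁ ∘ φ-surjective

Iso⇒≡ : ∀ {n m} {G : Digraph n} {H : Digraph m} → Iso G H → n ≡ m
Iso⇒≡ (f , _) = ≤-antisym (injective⇒≤ (Injection.injective (↔⇒↣ f)))
                          (injective⇒≤ (Injection.injective (↔⇒↣ (↔-sym f))))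

classification : ∀ n (G : Digraph n) → Good G → Iso G H₇ ⊎ Iso G H₈
classification zero    G (() , _)
classification (suc n) G (_ , reg , dom , no2 , conn) =
  Sum.map (certified-homomorphism⇒iso {H = H₇} certificate₇)
          (certified-homomorphism⇒iso {H = H₈} certificate₈)
          (H₇-or-H₈ zero)
  where
  open Structure G reg dom no2 using (H₇-or-H₈)
  open Counting G reg dom no2 using (indegree≡3)
  certified-homomorphism⇒iso : ∀ {m} {H : Digraph (suc m)} → Certificate H → Homomorphism H G → Iso G H
  certified-homomorphism⇒iso {H = H} (outH , inH , _ , _ , nearH) (φ , hom) =
    homomorphism⇒iso {H = H} {G = G} outH inH nearH reg indegree≡3 no2 conn φ hom

lemma3p4 : Σ ℕ λ n₁ → Σ (Digraph n₁) λ G₁ → Σ ℕ λ n₂ → Σ (Digraph n₂) λ G₂ →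
    Good G₁ × Good G₂ × ¬ Iso G₁ G₂ ×
    (∀ (n : ℕ) (G : Digraph n) → Good G → Iso G G₁ ⊎ Iso G G₂)
lemma3p4 = 7 , H₇ , 8 , H₈ , certified⇒good {H = H₇} certificate₇ , certified⇒good {H = H₈} certificate₈ ,
           (λ iso → case Iso⇒≡ {G = H₇} {H = H₈} iso of λ ()) , classification
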